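{- For every $n\geq 2$, letting $P_n$ be the path on $n$ vertices: (i) ${\rm I}_e(P_n)=\frac{n-1}{3}$ if $n\equiv 1 \pmod 3$; (ii) ${\rm I}_e(P_n)=\lceil \frac{n-1}{3}\rceil$ if $n\equiv 2 \pmod 3$; (iii) ${\rm I}_e(P_n)=\lfloor \frac{n-1}{3}\rfloor$ otherwise. Moreover, for every $n\geq 3$, letting $C_n$ be the cycle on $n$ vertices, ${\rm I}_e(C_n)={\rm I}_e(P_n)+1$.
   Context: All graphs are finite and simple. A graph is locally irregular if no two adjacent vertices have the same degree. For a graph $G=(V,E)$, a set $S\subseteq E$ is an edge-irregulator of $G$ if $G-S$ is locally irregular, and ${\rm I}_e(G)$ is the minimum cardinality of an edge-irregulator of $G$. -}

module Defs where

open import Data.Nat using (ℕ; zero; suc; _+_; _≤_; NonZero)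
open import Data.Nat.DivMod using (_mod_)
open import Data.Fin using (Fin; toℕ; inject₁; _≟_) renaming (suc to fsuc)
open import Data.Fin.Subset using (Subset; _∈_; _∉_; ∣_∣)
open import Data.Product using (_×_; _,_; proj₁; proj₂; ∃)
open import Data.List using (List; allFin; filter; length)
open import Data.Sum using (_⊎_)
open import Relation.Nullary using (¬_; Dec; yes; no)
open import Relation.Nullary.Decidable using (_⊎-dec_; ¬?; _×-dec_)
open import Relation.Binary.PropositionalEquality using (_≡_)
open import Data.Fin.Subset.Properties using (_∈?_)

record Graph : Set where
  field
    V    : ℕ
    E    : ℕ
    ends : Fin E → Fin V × Fin V
open Graph public

Incident : (G : Graph) → Fin (V G) → Fin (E G) → Set
Incident G v e = (v ≡ proj₁ (ends G e)) ⊎ (v ≡ proj₂ (ends G e))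

incident? : (G : Graph) (v : Fin (V G)) (e : Fin (E G)) → Dec (Incident G v e)
incident? G v e = (v ≟ proj₁ (ends G e)) ⊎-dec (v ≟ proj₂ (ends G e))

degMinus : (G : Graph) → Subset (E G) → Fin (V G) → ℕ
degMinus G S v =
  length (filter (λ e → ¬? (e ∈? S) ×-dec incident? G v e) (allFin (E G)))

LocallyIrregularMinus : (G : Graph) → Subset (E G) → Set
LocallyIrregularMinus G S =
  ∀ e → e ∉ S →
    ¬ (degMinus G S (proj₁ (ends G e)) ≡ degMinus G S (proj₂ (ends G e)))

IsEdgeIrregulator : (G : Graph) → Subset (E G) → Set
IsEdgeIrregulator G S = LocallyIrregularMinus G S

IeIs : Graph → ℕ → Set
IeIs G k =
  (∃ λ S → IsEdgeIrregulator G S × ∣ S ∣ ≡ k) ×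
  (∀ S → IsEdgeIrregulator G S → k ≤ ∣ S ∣)

path : ℕ → Graph
path zero    = record { V = zero ; E = zero ; ends = λ () }
path (suc m) = record { V = suc m ; E = m ; ends = λ i → inject₁ i , fsuc i }

cycle : ℕ → Graph
cycle zero    = record { V = zero ; E = zero ; ends = λ () }
cycle (suc m) = record { V = suc m ; E = suc m
                       ; ends = λ i → i , (suc (toℕ i) mod suc m) }

{-# OPTIONS --safe #-}
-- On a path or a cycle, an edge kept in G - S joins vertices of different degrees exactly when the
-- two edges beside it have different status, so S is an edge-irregulator iff the kept edges come in
-- runs of exactly two. Reading such a pattern off from the first edge of a path shows that each
-- block of three edges (two kept, one removed) costs one removal, which gives I_e(P_n).
-- A cycle on at least three vertices is 2-regular, so some edge is removed; rotating the cycle at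
-- most twice makes a removed edge the closing one, and what remains is an edge-irregulator of P_n.
module Submission where

open import Defs
open import Data.Nat using (ℕ; suc; _≤_; _∸_; _+_)
open import Data.Nat.DivMod using (_/_; _%_)
open import Data.Product using (_×_)
open import Relation.Binary.PropositionalEquality using (_≡_)

open import Data.Nat using (zero; z≤n; s≤s)
open import Data.Nat.Properties using (+-0-monoid; +-comm; +-assoc; +-identityʳ; ≤-trans; ≤-antisym)
open import Data.Nat.DivMod using (_mod_; m≤n⇒m%n≡m; n%n≡0; m/n≡1+[m∸n]/n)
open import Algebra.Properties.Monoid.Sum +-0-monoid
  using (sum; sum-cong-≗; sum-init-last; sum-replicate-zero)
open import Data.Bool using (Bool; true; false; not; _∧_; _∨_)
open import Data.Bool.Properties using (∧-zeroʳ; ∨-identityʳ)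
open import Data.Empty using (⊥-elim)
open import Data.Fin using (Fin; toℕ; inject₁; fromℕ; _≟_) renaming (zero to fzero; suc to fsuc)
open import Data.Fin.Induction using (>-weakInduction)
open import Data.Fin.Properties using (toℕ-injective; toℕ-fromℕ<; toℕ-fromℕ; toℕ-inject₁; toℕ<n)
open import Data.Fin.Subset using (Subset; _∈_; _∉_; ∣_∣)
open import Data.Fin.Subset.Properties using (_∈?_; drop-there)
open import Data.List using (filter; length; tabulate)
open import Data.Product using (_,_; proj₁; proj₂)
open import Data.Sum using (_⊎_; inj₁; inj₂)
open import Data.Unit using (⊤; tt)
open import Data.Vec using ([]; _∷_; _∷ʳ_; initLast; here; there)
open import Function using (_∘_; id; _⇔_; mk⇔; Equivalence)
open import Function.Construct.Composition using (_⇔-∘_)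
open import Level using (0ℓ)
open import Relation.Nullary using (¬_; does)
open import Relation.Nullary.Decidable using (¬?; _×-dec_; does-⇔; dec-true; dec-false)
open import Relation.Unary using (Pred; Decidable)
open import Relation.Binary.PropositionalEquality
  using (_≢_; refl; sym; trans; cong; cong₂; subst; subst₂; module ≡-Reasoning)

open Equivalence using (to; from)

indicator : Bool → ℕ
indicator true  = 1
indicator false = 0

length-filter-tabulate : ∀ {A : Set} {P : Pred A 0ℓ} (P? : Decidable P) {n} (g : Fin n → A) →
                         length (filter P? (tabulate g)) ≡ sum (λ i → indicator (does (P? (g i))))
length-filter-tabulate P? {zero}  g = refl
length-filter-tabulate P? {suc n} g with does (P? (g fzero))
... | true  = cong suc (length-filter-tabulate P? (g ∘ fsuc))
... | false = length-filter-tabulate P? (g ∘ fsuc)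

incidence : (G : Graph) → Subset (E G) → Fin (V G) → Fin (E G) → Bool
incidence G S v e = does (¬? (e ∈? S) ×-dec incident? G v e)

degMinus≡sum : ∀ G S v → degMinus G S v ≡ sum (indicator ∘ incidence G S v)
degMinus≡sum G S v = length-filter-tabulate (λ e → ¬? (e ∈? S) ×-dec incident? G v e) id

incidence-ends : ∀ G S v e {a b} → ends G e ≡ (a , b) →
                 incidence G S v e ≡ not (does (e ∈? S)) ∧ (does (v ≟ a) ∨ does (v ≟ b))
incidence-ends G S v e = cong λ ab → not (does (e ∈? S)) ∧ (does (v ≟ proj₁ ab) ∨ does (v ≟ proj₂ ab))

edge-irregular⇔ : ∀ G S (d : Fin (V G) → ℕ) → (∀ v → degMinus G S v ≡ d v) →
                  ∀ e {a b} → ends G e ≡ (a , b) →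
                  (¬ degMinus G S (proj₁ (ends G e)) ≡ degMinus G S (proj₂ (ends G e)))
                  ⇔ (d a ≢ d b)
edge-irregular⇔ G S d deg≡d e {a} {b} ends≡ rewrite ends≡ | deg≡d a | deg≡d b = mk⇔ id id

-- Edge statuses are Booleans as in Subset: true means removed.
kept : Bool → ℕ
kept true  = 0
kept false = 1

-- The vertex degrees of a path whose edges have statuses S, with a pendant edge of status l at
-- the first vertex and one of status r at the last; vertex v lies between edges v - 1 and v.
-- P_n - S is the case l = r = true, and C_n - S the case where l and r are both the closing edge.
degree : ∀ {m} → Bool → Subset m → Bool → Fin (suc m) → ℕ
degree l []      r fzero    = kept l + kept r
degree l []      r (fsuc ())
degree l (x ∷ S) r fzero    = kept l + kept x
degree l (x ∷ S) r (fsuc v) = degree x S r v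

headOr : ∀ {m} → Bool → Subset m → Bool
headOr r []      = r
headOr r (x ∷ _) = x

lastOr : ∀ {m} → Bool → Subset m → Bool
lastOr l []      = l
lastOr l (x ∷ S) = lastOr x S

-- A kept edge x between edges of statuses a and b joins vertices of degrees kept a + kept x and
-- kept x + kept b.
Irregular : ∀ {m} → Bool → Subset m → Bool → Set
Irregular l []      r = ⊤
Irregular l (x ∷ S) r = (x ≡ false → l ≢ headOr r S) × Irregular x S r

distinct-degrees⇔distinct-neighbours : ∀ a x b → (kept a + kept x ≢ kept x + kept b) ⇔ (a ≢ b)
distinct-degrees⇔distinct-neighbours a x b =
  mk⇔ (λ { a≢b refl → a≢b (+-comm (kept a) (kept x)) }) (λ a≢b → a≢b ∘ cancel a x b)
  where
  cancel : ∀ a x b → kept a + kept x ≡ kept x + kept b → a ≡ b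
  cancel true  _     true  _ = refl
  cancel false _     false _ = refl
  cancel true  true  false ()
  cancel true  false false ()
  cancel false true  true  ()
  cancel false false true  ()

degree-head : ∀ {m} l (S : Subset m) r → degree l S r fzero ≡ kept l + kept (headOr r S)
degree-head l []      r = refl
degree-head l (x ∷ S) r = refl

degree-last : ∀ {m} l (S : Subset m) r → degree l S r (fromℕ m) ≡ kept (lastOr l S) + kept r
degree-last l []      r = refl
degree-last l (x ∷ S) r = degree-last x S r

irregular⇒ : ∀ {m l r} (S : Subset m) →
             (∀ e → e ∉ S → degree l S r (inject₁ e) ≢ degree l S r (fsuc e)) → Irregular l S r
irregular⇒ []      h = tt
irregular⇒ {l = l} {r} (x ∷ S) h = first-edge , irregular⇒ S (λ e e∉S → h (fsuc e) (e∉S ∘ drop-there))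
  where
  first-edge : x ≡ false → l ≢ headOr r S
  first-edge refl = to (distinct-degrees⇔distinct-neighbours l false (headOr r S))
                       (subst (kept l + 1 ≢_) (degree-head false S r) (h fzero λ ()))

irregular⇐ : ∀ {m l r} (S : Subset m) → Irregular l S r →
             ∀ e → e ∉ S → degree l S r (inject₁ e) ≢ degree l S r (fsuc e)
irregular⇐ (true ∷ S) _ fzero e∉S = ⊥-elim (e∉S here)
irregular⇐ {l = l} {r} (false ∷ S) (first-edge , _) fzero _ =
  subst (kept l + 1 ≢_) (sym (degree-head false S r))
        (from (distinct-degrees⇔distinct-neighbours l false (headOr r S)) (first-edge refl))
irregular⇐ (x ∷ S) (_ , irr) (fsuc e) e∉S = irregular⇐ S irr e (e∉S ∘ there)

closing-edge⇔ : ∀ {m} t (S : Subset m) →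
                (degree t S t (fromℕ m) ≢ degree t S t fzero) ⇔ (lastOr t S ≢ headOr t S)
closing-edge⇔ t S rewrite degree-last t S t | degree-head t S t =
  distinct-degrees⇔distinct-neighbours (lastOr t S) t (headOr t S)

firstPendant : ∀ {m} → Bool → Fin (suc m) → ℕ
firstPendant b fzero    = kept b
firstPendant b (fsuc _) = 0

lastPendant : ∀ {m} → Bool → Fin (suc m) → ℕ
lastPendant {zero}  b fzero    = kept b
lastPendant {suc m} b fzero    = 0
lastPendant {suc m} b (fsuc v) = lastPendant b v

firstPendant-removed : ∀ {m} (v : Fin (suc m)) → firstPendant true v ≡ 0
firstPendant-removed fzero    = refl
firstPendant-removed (fsuc v) = refl

lastPendant-removed : ∀ {m} (v : Fin (suc m)) → lastPendant true v ≡ 0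
lastPendant-removed {zero}  fzero    = refl
lastPendant-removed {suc m} fzero    = refl
lastPendant-removed {suc m} (fsuc v) = lastPendant-removed v

lastPendant-kept : ∀ {m} (v : Fin (suc m)) → indicator (does (v ≟ fromℕ m)) ≡ lastPendant false v
lastPendant-kept {zero}  fzero    = refl
lastPendant-kept {suc m} fzero    = refl
lastPendant-kept {suc m} (fsuc v) = lastPendant-kept v

sum-∧-false : ∀ {n} (b : Fin n → Bool) → sum (λ e → indicator (b e ∧ false)) ≡ 0
sum-∧-false {n} b = trans (sum-cong-≗ (λ e → cong indicator (∧-zeroʳ (b e)))) (sum-replicate-zero n)

first-edge-incidence : ∀ {m} x (S : Subset m) (v : Fin (suc m)) →
                       indicator (not (does (fzero ∈? (x ∷ S))) ∧ does (v ≟ fzero)) ≡ firstPendant x v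
first-edge-incidence true  S fzero    = refl
first-edge-incidence true  S (fsuc v) = refl
first-edge-incidence false S fzero    = refl
first-edge-incidence false S (fsuc v) = refl

path-incidences : ∀ {m} l (S : Subset m) r v →
                  firstPendant l v + sum (indicator ∘ incidence (path (suc m)) S v) + lastPendant r v
                  ≡ degree l S r v
path-incidences l []          r fzero = cong (_+ kept r) (+-identityʳ (kept l))
path-incidences l (true ∷ S)  r fzero =
  trans (cong (λ s → kept l + s + 0) (sum-∧-false λ e → not (does (fsuc e ∈? (true ∷ S)))))
        (+-identityʳ _)
path-incidences l (false ∷ S) r fzero =
  trans (cong (λ s → kept l + suc s + 0) (sum-∧-false λ e → not (does (fsuc e ∈? (false ∷ S)))))
        (+-identityʳ _)
path-incidences {suc m} l (x ∷ S) r (fsuc v) =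
  trans (cong (λ a → a + sum (indicator ∘ incidence (path (suc m)) S v) + lastPendant r v)
              (first-edge-incidence x S v))
        (path-incidences x S r v)

path-degree : ∀ {m} (S : Subset m) v → degMinus (path (suc m)) S v ≡ degree true S true v
path-degree {m} S v = begin
  degMinus (path (suc m)) S v                   ≡⟨ degMinus≡sum (path (suc m)) S v ⟩
  Σ                                             ≡⟨ sym (+-identityʳ Σ) ⟩
  0 + Σ + 0                                     ≡⟨ sym (cong₂ (λ a c → a + Σ + c)
                                                             (firstPendant-removed v) (lastPendant-removed v)) ⟩
  firstPendant true v + Σ + lastPendant true v  ≡⟨ path-incidences true S true v ⟩
  degree true S true v                          ∎
  where
  open ≡-Reasoning
  Σ : ℕ
  Σ = sum (indicator ∘ incidence (path (suc m)) S v)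

path-irregulator⇔ : ∀ {m} (S : Subset m) → IsEdgeIrregulator (path (suc m)) S ⇔ Irregular true S true
path-irregulator⇔ {m} S = mk⇔
  (λ h → irregular⇒ S λ e e∉S → to (edge e) (h e e∉S))
  (λ irr e e∉S → from (edge e) (irregular⇐ S irr e e∉S))
  where
  edge : ∀ e → (¬ degMinus (path (suc m)) S (inject₁ e) ≡ degMinus (path (suc m)) S (fsuc e))
               ⇔ (degree true S true (inject₁ e) ≢ degree true S true (fsuc e))
  edge e = edge-irregular⇔ (path (suc m)) S (degree true S true) (path-degree S) e refl

cycle-ends-inject₁ : ∀ {m} (e : Fin (suc m)) → ends (cycle (2 + m)) (inject₁ e) ≡ (inject₁ e , fsuc e)
cycle-ends-inject₁ {m} e = cong (inject₁ e ,_) (toℕ-injective (begin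
  toℕ (suc (toℕ (inject₁ e)) mod (2 + m)) ≡⟨ toℕ-fromℕ< _ ⟩
  suc (toℕ (inject₁ e)) % (2 + m)         ≡⟨ cong (λ i → suc i % (2 + m)) (toℕ-inject₁ e) ⟩
  suc (toℕ e) % (2 + m)                   ≡⟨ m≤n⇒m%n≡m (toℕ<n e) ⟩
  suc (toℕ e)                             ∎))
  where open ≡-Reasoning

cycle-ends-fromℕ : ∀ m → ends (cycle (2 + m)) (fromℕ (suc m)) ≡ (fromℕ (suc m) , fzero)
cycle-ends-fromℕ m = cong (fromℕ (suc m) ,_) (toℕ-injective (begin
  toℕ (suc (toℕ (fromℕ (suc m))) mod (2 + m)) ≡⟨ toℕ-fromℕ< _ ⟩
  suc (toℕ (fromℕ (suc m))) % (2 + m)         ≡⟨ cong (λ i → suc i % (2 + m)) (toℕ-fromℕ (suc m)) ⟩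
  (2 + m) % (2 + m)                           ≡⟨ n%n≡0 (2 + m) ⟩
  0                                           ∎))
  where open ≡-Reasoning

∈-∷ʳ⁺ : ∀ {m} {T : Subset m} {e} t → e ∈ T → inject₁ e ∈ T ∷ʳ t
∈-∷ʳ⁺ t here        = here
∈-∷ʳ⁺ t (there e∈T) = there (∈-∷ʳ⁺ t e∈T)

∈-∷ʳ⁻ : ∀ {m} (T : Subset m) {e} t → inject₁ e ∈ T ∷ʳ t → e ∈ T
∈-∷ʳ⁻ (x ∷ T) {fzero}  t here        = here
∈-∷ʳ⁻ (x ∷ T) {fsuc e} t (there e∈T) = there (∈-∷ʳ⁻ T t e∈T)

fromℕ-∈-∷ʳ : ∀ {m} (T : Subset m) → fromℕ m ∈ T ∷ʳ true
fromℕ-∈-∷ʳ []      = here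
fromℕ-∈-∷ʳ (x ∷ T) = there (fromℕ-∈-∷ʳ T)

fromℕ-∉-∷ʳ : ∀ {m} (T : Subset m) → fromℕ m ∉ T ∷ʳ false
fromℕ-∉-∷ʳ []      ()
fromℕ-∉-∷ʳ (x ∷ T) (there p) = fromℕ-∉-∷ʳ T p

fromℕ-∉-∷ʳ⁻ : ∀ {m} (T : Subset m) {t} → fromℕ m ∉ T ∷ʳ t → t ≡ false
fromℕ-∉-∷ʳ⁻ T {true}  ∉T∷ʳt = ⊥-elim (∉T∷ʳt (fromℕ-∈-∷ʳ T))
fromℕ-∉-∷ʳ⁻ T {false} _     = refl

does-fromℕ-∈-∷ʳ : ∀ {m} (T : Subset m) t → does (fromℕ m ∈? T ∷ʳ t) ≡ t
does-fromℕ-∈-∷ʳ T true  = dec-true  (fromℕ _ ∈? T ∷ʳ true)  (fromℕ-∈-∷ʳ T)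
does-fromℕ-∈-∷ʳ T false = dec-false (fromℕ _ ∈? T ∷ʳ false) (fromℕ-∉-∷ʳ T)

closing-incidence : ∀ {m} t (v : Fin (2 + m)) →
                    indicator (not t ∧ (does (v ≟ fromℕ (suc m)) ∨ does (v ≟ fzero)))
                    ≡ firstPendant t v + lastPendant t v
closing-incidence true  fzero    = refl
closing-incidence true  (fsuc v) = sym (lastPendant-removed v)
closing-incidence false fzero    = refl
closing-incidence false (fsuc v) = trans (cong indicator (∨-identityʳ _)) (lastPendant-kept v)

cycle-degree : ∀ {m} (T : Subset (suc m)) t v → degMinus (cycle (2 + m)) (T ∷ʳ t) v ≡ degree t T t v
cycle-degree {m} T t v = begin
  degMinus C S v                                  ≡⟨ degMinus≡sum C S v ⟩
  sum (indicator ∘ incidence C S v)               ≡⟨ sum-init-last (indicator ∘ incidence C S v) ⟩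
  sum (indicator ∘ incidence C S v ∘ inject₁) + indicator (incidence C S v (fromℕ (suc m)))
                                                  ≡⟨ cong₂ _+_ (sum-cong-≗ path-edge) closing-edge ⟩
  Σ + (firstPendant t v + lastPendant t v)        ≡⟨ sym (+-assoc Σ _ _) ⟩
  Σ + firstPendant t v + lastPendant t v          ≡⟨ cong (_+ lastPendant t v) (+-comm Σ _) ⟩
  firstPendant t v + Σ + lastPendant t v          ≡⟨ path-incidences t T t v ⟩
  degree t T t v                                  ∎
  where
  open ≡-Reasoning
  C : Graph
  C = cycle (2 + m)
  S : Subset (2 + m)
  S = T ∷ʳ t
  Σ : ℕ
  Σ = sum (indicator ∘ incidence (path (2 + m)) T v)
  path-edge : ∀ e → indicator (incidence C S v (inject₁ e)) ≡ indicator (incidence (path (2 + m)) T v e)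
  path-edge e = cong indicator (trans (incidence-ends C S v (inject₁ e) (cycle-ends-inject₁ e))
    (cong (λ b → not b ∧ (does (v ≟ inject₁ e) ∨ does (v ≟ fsuc e)))
          (does-⇔ (mk⇔ (∈-∷ʳ⁻ T t) (∈-∷ʳ⁺ t)) (inject₁ e ∈? S) (e ∈? T))))
  closing-edge : indicator (incidence C S v (fromℕ (suc m))) ≡ firstPendant t v + lastPendant t v
  closing-edge = trans (cong indicator (trans (incidence-ends C S v (fromℕ (suc m)) (cycle-ends-fromℕ m))
    (cong (λ b → not b ∧ (does (v ≟ fromℕ (suc m)) ∨ does (v ≟ fzero))) (does-fromℕ-∈-∷ʳ T t))))
    (closing-incidence t v)

CyclicIrregular : ∀ {m} → Subset m → Bool → Set
CyclicIrregular T t = Irregular t T t × (t ≡ false → lastOr t T ≢ headOr t T)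

cycle-irregulator⇔ : ∀ {m} (T : Subset (suc m)) t →
                     IsEdgeIrregulator (cycle (2 + m)) (T ∷ʳ t) ⇔ CyclicIrregular T t
cycle-irregulator⇔ {m} T t = mk⇔
  (λ h → irregular⇒ T (λ e e∉T → to (path-edge e) (h (inject₁ e) (e∉T ∘ ∈-∷ʳ⁻ T t)))
       , λ { refl → to closing-edge (h (fromℕ (suc m)) (fromℕ-∉-∷ʳ T)) })
  (λ (irr , closing) → >-weakInduction EdgeIrregular
     (λ e∉S → from closing-edge (closing (fromℕ-∉-∷ʳ⁻ T e∉S)))
     (λ e _ e∉S → from (path-edge e) (irregular⇐ T irr e (e∉S ∘ ∈-∷ʳ⁺ t))))
  where
  C : Graph
  C = cycle (2 + m)
  S : Subset (2 + m)
  S = T ∷ʳ t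
  EdgeIrregular : Fin (2 + m) → Set
  EdgeIrregular e = e ∉ S → ¬ degMinus C S (proj₁ (ends C e)) ≡ degMinus C S (proj₂ (ends C e))
  path-edge : ∀ e → (¬ degMinus C S (inject₁ e) ≡ degMinus C S (proj₂ (ends C (inject₁ e))))
                    ⇔ (degree t T t (inject₁ e) ≢ degree t T t (fsuc e))
  path-edge e = edge-irregular⇔ C S (degree t T t) (cycle-degree T t) (inject₁ e) (cycle-ends-inject₁ e)
  closing-edge : (¬ degMinus C S (fromℕ (suc m)) ≡ degMinus C S (proj₂ (ends C (fromℕ (suc m)))))
                 ⇔ (lastOr t T ≢ headOr t T)
  closing-edge = closing-edge⇔ t T
             ⇔-∘ edge-irregular⇔ C S (degree t T t) (cycle-degree T t) (fromℕ (suc m)) (cycle-ends-fromℕ m)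

-- I_e of the path with m edges, that is, of P (m + 1).
pathIe : ℕ → ℕ
pathIe 0                   = 0
pathIe 1                   = 1
pathIe 2                   = 0
pathIe (suc (suc (suc m))) = suc (pathIe m)

pathIe-suc : ∀ m → pathIe (suc m) ≤ suc (pathIe m)
pathIe-suc 0                   = s≤s z≤n
pathIe-suc 1                   = z≤n
pathIe-suc 2                   = s≤s z≤n
pathIe-suc (suc (suc (suc m))) = s≤s (pathIe-suc m)

optimalIrregulator : ∀ m → Subset m
optimalIrregulator 0                   = []
optimalIrregulator 1                   = true ∷ []
optimalIrregulator 2                   = false ∷ false ∷ []
optimalIrregulator (suc (suc (suc m))) = false ∷ false ∷ true ∷ optimalIrregulator m

optimalIrregulator-irregular : ∀ m → Irregular true (optimalIrregulator m) true
optimalIrregulator-irregular 0                   = tt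
optimalIrregulator-irregular 1                   = (λ ()) , tt
optimalIrregulator-irregular 2                   = (λ _ ()) , (λ _ ()) , tt
optimalIrregulator-irregular (suc (suc (suc m))) =
  (λ _ ()) , (λ _ ()) , (λ ()) , optimalIrregulator-irregular m

∣optimalIrregulator∣ : ∀ m → ∣ optimalIrregulator m ∣ ≡ pathIe m
∣optimalIrregulator∣ 0                   = refl
∣optimalIrregulator∣ 1                   = refl
∣optimalIrregulator∣ 2                   = refl
∣optimalIrregulator∣ (suc (suc (suc m))) = cong suc (∣optimalIrregulator∣ m)

irregular-lower-bound : ∀ {m} (S : Subset m) → Irregular true S true → pathIe m ≤ ∣ S ∣
irregular-lower-bound []                          _                 = z≤n
irregular-lower-bound {suc m} (true ∷ S)          (_ , irr)         =
  ≤-trans (pathIe-suc m) (s≤s (irregular-lower-bound S irr))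
irregular-lower-bound (false ∷ [])                (first , _)       = ⊥-elim (first refl refl)
irregular-lower-bound (false ∷ true ∷ S)          (first , _)       = ⊥-elim (first refl refl)
irregular-lower-bound (false ∷ false ∷ [])        _                 = z≤n
irregular-lower-bound (false ∷ false ∷ false ∷ S) (_ , second , _)  = ⊥-elim (second refl refl)
irregular-lower-bound (false ∷ false ∷ true ∷ S)  (_ , _ , _ , irr) = s≤s (irregular-lower-bound S irr)

path-Ie : ∀ m → IeIs (path (suc m)) (pathIe m)
path-Ie m =
    ( optimalIrregulator m
    , from (path-irregulator⇔ _) (optimalIrregulator-irregular m)
    , ∣optimalIrregulator∣ m )
  , λ S irr → irregular-lower-bound S (to (path-irregulator⇔ S) irr)

IeIs-unique : ∀ {G k k′} → IeIs G k → IeIs G k′ → k ≡ k′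
IeIs-unique ((S , irr , refl) , minimal) ((S′ , irr′ , refl) , minimal′) =
  ≤-antisym (minimal S′ irr′) (minimal′ S irr)

∣p∷ʳx∣≡∣x∷p∣ : ∀ {m} (p : Subset m) x → ∣ p ∷ʳ x ∣ ≡ ∣ x ∷ p ∣
∣p∷ʳx∣≡∣x∷p∣ []          x     = refl
∣p∷ʳx∣≡∣x∷p∣ (true ∷ p)  true  = cong suc (∣p∷ʳx∣≡∣x∷p∣ p true)
∣p∷ʳx∣≡∣x∷p∣ (true ∷ p)  false = cong suc (∣p∷ʳx∣≡∣x∷p∣ p false)
∣p∷ʳx∣≡∣x∷p∣ (false ∷ p) x     = ∣p∷ʳx∣≡∣x∷p∣ p x

headOr-∷ʳ : ∀ {m} r (T : Subset m) t → headOr r (T ∷ʳ t) ≡ headOr t T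
headOr-∷ʳ r []      t = refl
headOr-∷ʳ r (x ∷ T) t = refl

lastOr-∷ʳ : ∀ {m} l (T : Subset m) t → lastOr l (T ∷ʳ t) ≡ t
lastOr-∷ʳ l []      t = refl
lastOr-∷ʳ l (x ∷ T) t = lastOr-∷ʳ x T t

Irregular-∷ʳ : ∀ {m} l (T : Subset m) t r →
               Irregular l T t → (t ≡ false → lastOr l T ≢ r) → Irregular l (T ∷ʳ t) r
Irregular-∷ʳ l []      t r tt            last = last , tt
Irregular-∷ʳ l (x ∷ T) t r (first , irr) last =
  subst (λ h → x ≡ false → l ≢ h) (sym (headOr-∷ʳ r T t)) first , Irregular-∷ʳ x T t r irr last

CyclicIrregular-rotate : ∀ {m} x (T : Subset m) t → CyclicIrregular (x ∷ T) t → CyclicIrregular (T ∷ʳ t) x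
CyclicIrregular-rotate x T t ((first , irr) , closing) =
  Irregular-∷ʳ x T t x irr closing , subst₂ _≢_ (sym (lastOr-∷ʳ x T t)) (sym (headOr-∷ʳ x T t)) ∘ first

closing-removed-lower-bound : ∀ {m} (T : Subset m) → Irregular true T true →
                              suc (pathIe m) ≤ ∣ T ∷ʳ true ∣
closing-removed-lower-bound T irr =
  subst (suc (pathIe _) ≤_) (sym (∣p∷ʳx∣≡∣x∷p∣ T true)) (s≤s (irregular-lower-bound T irr))

cyclic-lower-bound : ∀ {m} (T : Subset (2 + m)) t → CyclicIrregular T t →
                     suc (pathIe (2 + m)) ≤ ∣ T ∷ʳ t ∣
cyclic-lower-bound T true (irr , _) = closing-removed-lower-bound T irr
cyclic-lower-bound (true ∷ T) false irr =
  subst (_ ≤_) (∣p∷ʳx∣≡∣x∷p∣ (T ∷ʳ false) true)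
        (closing-removed-lower-bound (T ∷ʳ false) (proj₁ (CyclicIrregular-rotate true T false irr)))
cyclic-lower-bound (false ∷ false ∷ T) false ((first , _) , _) = ⊥-elim (first refl refl)
cyclic-lower-bound (false ∷ true ∷ T) false irr =
  subst (_ ≤_) (trans (∣p∷ʳx∣≡∣x∷p∣ ((T ∷ʳ false) ∷ʳ false) true)
                      (cong suc (∣p∷ʳx∣≡∣x∷p∣ (T ∷ʳ false) false)))
        (closing-removed-lower-bound ((T ∷ʳ false) ∷ʳ false) (proj₁ twice-rotated))
  where
  twice-rotated : CyclicIrregular ((T ∷ʳ false) ∷ʳ false) true
  twice-rotated =
    CyclicIrregular-rotate true (T ∷ʳ false) false (CyclicIrregular-rotate false (true ∷ T) false irr)

cycle-Ie : ∀ m → IeIs (cycle (3 + m)) (suc (pathIe (2 + m)))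
cycle-Ie m =
    ( O ∷ʳ true
    , from (cycle-irregulator⇔ O true) (optimalIrregulator-irregular (2 + m) , λ ())
    , trans (∣p∷ʳx∣≡∣x∷p∣ O true) (cong suc (∣optimalIrregulator∣ (2 + m))) )
  , lower-bound
  where
  O : Subset (2 + m)
  O = optimalIrregulator (2 + m)
  lower-bound : ∀ S → IsEdgeIrregulator (cycle (3 + m)) S → suc (pathIe (2 + m)) ≤ ∣ S ∣
  lower-bound S irr with initLast S
  ... | T , t , refl = cyclic-lower-bound T t (to (cycle-irregulator⇔ T t) irr)

[3+m]/3≡1+m/3 : ∀ m → (3 + m) / 3 ≡ suc (m / 3)
[3+m]/3≡1+m/3 m = m/n≡1+[m∸n]/n {3 + m} {3} (s≤s (s≤s (s≤s z≤n)))

pathIe≡⌊m/3⌋ : ∀ m → suc m % 3 ≡ 0 ⊎ suc m % 3 ≡ 1 → pathIe m ≡ m / 3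
pathIe≡⌊m/3⌋ 0                   _         = refl
pathIe≡⌊m/3⌋ 1                   (inj₁ ())
pathIe≡⌊m/3⌋ 1                   (inj₂ ())
pathIe≡⌊m/3⌋ 2                   _         = refl
pathIe≡⌊m/3⌋ (suc (suc (suc m))) h         =
  trans (cong suc (pathIe≡⌊m/3⌋ m h)) (sym ([3+m]/3≡1+m/3 m))

pathIe≡⌈m/3⌉ : ∀ m → suc m % 3 ≡ 2 → pathIe m ≡ (m + 2) / 3
pathIe≡⌈m/3⌉ 0                   ()
pathIe≡⌈m/3⌉ 1                   _ = refl
pathIe≡⌈m/3⌉ 2                   ()
pathIe≡⌈m/3⌉ (suc (suc (suc m))) h =
  trans (cong suc (pathIe≡⌈m/3⌉ m h)) (sym ([3+m]/3≡1+m/3 (m + 2)))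

theorem4 : ((n : ℕ) → 2 ≤ n →
             (n % 3 ≡ 1 → IeIs (path n) ((n ∸ 1) / 3)) ×
             (n % 3 ≡ 2 → IeIs (path n) ((n ∸ 1 + 2) / 3)) ×
             (n % 3 ≡ 0 → IeIs (path n) ((n ∸ 1) / 3))) ×
           ((n : ℕ) → 3 ≤ n → (k : ℕ) → IeIs (path n) k → IeIs (cycle n) (suc k))
theorem4 =
    (λ { zero ()
       ; (suc m) _ →
           (λ n%3≡1 → subst (IeIs (path (suc m))) (pathIe≡⌊m/3⌋ m (inj₂ n%3≡1)) (path-Ie m))
         , (λ n%3≡2 → subst (IeIs (path (suc m))) (pathIe≡⌈m/3⌉ m n%3≡2) (path-Ie m))
         , (λ n%3≡0 → subst (IeIs (path (suc m))) (pathIe≡⌊m/3⌋ m (inj₁ n%3≡0)) (path-Ie m)) })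
  , (λ { (suc (suc (suc m))) _ k Ie≡k →
           subst (IeIs (cycle (3 + m)) ∘ suc) (IeIs-unique (path-Ie (2 + m)) Ie≡k) (cycle-Ie m)
       ; zero () ; (suc zero) (s≤s ()) ; (suc (suc zero)) (s≤s (s≤s ())) })
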